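{- Let $G$ be a complete signed graph, let $u\neq v$ with $\{u,v\}$ of sign $-$ in $G$, and let $H$ be obtained from $G$ by flipping the sign of $\{u,v\}$ to $+$. Then: \begin{enumerate} \item If $w\in N_{G^+}(u)\cap N_{G^+}(v)$, then $\mathrm{NonAgreement}_{G^+}(u,w)\geq\mathrm{NonAgreement}_{H^+}(u,w)$. \item If $w\in N_{G^+}(u)\setminus N_{G^+}(v)$, $|N_{G^+}(u)|<|N_{G^+}(w)|$, and $w\neq v$, then $\mathrm{NonAgreement}_{G^+}(u,w)<\mathrm{NonAgreement}_{H^+}(u,w)$. \item Let $T=|N_{G^+}(u)\,\Delta\,N_{G^+}(w)|$ where $w\in N_{G^+}(u)\setminus N_{G^+}(v)$, $|N_{G^+}(u)|\geq|N_{G^+}(w)|$, and $w\neq v$. Then (a) $T<|N_{G^+}(u)|$ implies $\mathrm{NonAgreement}_{G^+}(u,w)<\mathrm{NonAgreement}_{H^+}(u,w)$; (b) $T=|N_{G^+}(u)|$ implies $\mathrm{NonAgreement}_{G^+}(u,w)=\mathrm{NonAgreement}_{H^+}(u,w)$; (c) $T>|N_{G^+}(u)|$ implies $\mathrm{NonAgreement}_{G^+}(u,w)>\mathrm{NonAgreement}_{H^+}(u,w)$. \item If $w\notin N_{G^+}(u)\cup N_{G^+}(v)$ and $w\notin\{u,v\}$, then $\mathrm{NonAgreement}_{G^+}(x,w)=\mathrm{NonAgreement}_{H^+}(x,w)$ for every $x\in N_{G^+}(w)$. \end{enumerate}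
   Context: A complete signed graph on a finite vertex set $V$ assigns to every unordered pair of distinct vertices a sign $+$ or $-$. For such a graph $X$, its positive graph $X^+$ has vertex set $V$ and as edges the pairs of sign $+$; $N_{X^+}(a)$ is the open neighborhood of $a$ in $X^+$. $\mathrm{NonAgreement}_{X^+}(a,b)=\frac{|N_{X^+}(a)\,\Delta\,N_{X^+}(b)|}{\max\{|N_{X^+}(a)|,|N_{X^+}(b)|\}}$, where $\Delta$ is symmetric difference. -}

module Defs where

open import Data.Nat using (ℕ; zero; suc; _⊔_)
open import Data.Integer using (+_)
open import Data.Rational using (ℚ; 0ℚ; _/_)
open import Data.Bool using (Bool; true; false; _xor_)
open import Data.Fin using (Fin; _≟_)
open import Data.Fin.Subset using (Subset; ∣_∣)
open import Data.Vec using (tabulate; zipWith)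
open import Data.Product using (_×_; _,_)
open import Data.Sum using (_⊎_)
open import Relation.Nullary using (¬_; yes; no)
open import Relation.Binary.PropositionalEquality using (_≡_)

data Sign : Set where
  plus minus : Sign

-- A complete signed graph on vertex set Fin n: every unordered pair of
-- distinct vertices gets a sign; the diagonal values are irrelevant.
record CompleteSignedGraph (n : ℕ) : Set where
  field
    sign : Fin n → Fin n → Sign
    sign-sym : ∀ a b → sign a b ≡ sign b a
open CompleteSignedGraph public

isPlus : Sign → Bool
isPlus plus  = true
isPlus minus = false

N⁺ : ∀ {n} → CompleteSignedGraph n → Fin n → Subset n
N⁺ X a = tabulate λ b → neigh (a ≟ b) b
  where
  neigh : ∀ {p} → Relation.Nullary.Dec p → Fin _ → Bool
  neigh (yes _) _ = false
  neigh (no _)  b = isPlus (sign X a b)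

_Δ_ : ∀ {n} → Subset n → Subset n → Subset n
p Δ q = zipWith _xor_ p q

-- a/d as a rational, with the convention that it is 0 when d = 0
frac : ℕ → ℕ → ℚ
frac a zero    = 0ℚ
frac a (suc d) = (+ a) / suc d

NonAgreement : ∀ {n} → CompleteSignedGraph n → Fin n → Fin n → ℚ
NonAgreement X a b =
  frac ∣ N⁺ X a Δ N⁺ X b ∣ (∣ N⁺ X a ∣ ⊔ ∣ N⁺ X b ∣)

FlipToPlus : ∀ {n} → CompleteSignedGraph n → CompleteSignedGraph n → Fin n → Fin n → Set
FlipToPlus G H u v =
  (sign H u v ≡ plus) ×
  (∀ a b → ¬ (a ≡ b) → ¬ ((a ≡ u × b ≡ v) ⊎ (a ≡ v × b ≡ u)) → sign H a b ≡ sign G a b)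

{-# OPTIONS --safe #-}

-- Flipping {u, v} to + inserts v into N⁺(u) and leaves N⁺(x) unchanged for every
-- x ∉ {u, v}.  Hence for w ∉ {u, v}, with a = |N⁺(u)|, m = |N⁺(w)| and
-- T = |N⁺(u) Δ N⁺(w)|, the non-agreement of (u, w) moves from T / max(a, m) to
-- (T ∓ 1) / max(a + 1, m): minus if v ∈ N⁺(w) (part 1, a decrease), plus
-- otherwise.  In the latter case the denominator stays m when a < m (part 2, an
-- increase), and otherwise T / a is compared with (T + 1) / (a + 1), which is
-- decided by the sign of T − a (part 3).  In part 4 neither x nor w lies in
-- {u, v}, so nothing changes.

module Submission where

open import Defs
open import Data.Nat using (ℕ; suc; _⊔_; _*_; _+_; z≤n; s≤s; >-nonZero)
  renaming (_<_ to _<ℕ_; _≤_ to _≤ℕ_; _≥_ to _≥ℕ_; _>_ to _>ℕ_)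
import Data.Nat.Properties as ℕ
open import Data.Integer using (+_; +≤+; +<+)
import Data.Integer as ℤ
import Data.Integer.Properties as ℤ
open import Data.Rational using (_≤_; _<_; _>_; _≥_)
import Data.Rational.Properties as ℚ
open import Data.Rational.Unnormalised using (mkℚᵘ; *≤*; *<*)
import Data.Rational.Unnormalised.Properties as ℚᵘ
open import Data.Bool using (_xor_)
open import Data.Fin using (Fin; zero; suc; _≟_)
open import Data.Fin.Properties using (suc-injective)
open import Data.Fin.Subset using (Subset; outside; inside; ∣_∣; _∈_; _∉_; _─_; _∩_; _∪_)
open import Data.Fin.Subset.Properties using (x∈p∩q⁻; x∈p∪q⁺; p─q⊆p; x∈p⇒∣p-x∣<∣p∣)
open import Data.Vec using (Vec; _∷_; lookup; tabulate)
open import Data.Vec.Properties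
  using (lookup-zipWith; lookup∘tabulate; tabulate∘lookup; tabulate-cong; []=⇒lookup; lookup⇒[]=)
open import Data.Product using (_×_; _,_; proj₁; proj₂)
open import Data.Sum using (inj₁; inj₂)
open import Function using (_∋_; _∘_)
open import Relation.Nullary using (yes; no; contradiction)
open import Relation.Binary.PropositionalEquality

frac-cross-≤ : ∀ a c {b d} → 0 <ℕ b → 0 <ℕ d → a * d ≤ℕ c * b → frac a b ≤ frac c d
frac-cross-≤ a c {suc b} {suc d} _ _ ad≤cb = ℚ.toℚᵘ-cancel-≤
  (ℚᵘ.≤-respʳ-≃ (ℚᵘ.≃-sym (ℚ.toℚᵘ-fromℚᵘ (mkℚᵘ (+ c) d)))
  (ℚᵘ.≤-respˡ-≃ (ℚᵘ.≃-sym (ℚ.toℚᵘ-fromℚᵘ (mkℚᵘ (+ a) b)))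
    (*≤* (subst₂ ℤ._≤_ (ℤ.pos-* a (suc d)) (ℤ.pos-* c (suc b)) (+≤+ ad≤cb)))))

frac-cross-< : ∀ a c {b d} → 0 <ℕ b → 0 <ℕ d → a * d <ℕ c * b → frac a b < frac c d
frac-cross-< a c {suc b} {suc d} _ _ ad<cb = ℚ.toℚᵘ-cancel-<
  (ℚᵘ.<-respʳ-≃ (ℚᵘ.≃-sym (ℚ.toℚᵘ-fromℚᵘ (mkℚᵘ (+ c) d)))
  (ℚᵘ.<-respˡ-≃ (ℚᵘ.≃-sym (ℚ.toℚᵘ-fromℚᵘ (mkℚᵘ (+ a) b)))
    (*<* (subst₂ ℤ._<_ (ℤ.pos-* a (suc d)) (ℤ.pos-* c (suc b)) (+<+ ad<cb)))))

frac-mono-≤ : ∀ {a b c d} → a ≤ℕ c → d ≤ℕ b → 0 <ℕ d → frac a b ≤ frac c d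
frac-mono-≤ {a} {b} {c} {d} a≤c d≤b 0<d =
  frac-cross-≤ a c (ℕ.<-≤-trans 0<d d≤b) 0<d (ℕ.*-mono-≤ a≤c d≤b)

frac-monoˡ-< : ∀ {a c d} → a <ℕ c → 0 <ℕ d → frac a d < frac c d
frac-monoˡ-< {a} {c} {d} a<c 0<d = frac-cross-< a c 0<d 0<d (ℕ.*-monoˡ-< d {{>-nonZero 0<d}} a<c)

-- Cross-multiplying T / a against suc T / suc a compares T + T * a with a + T * a.

frac-<-frac-suc-suc : ∀ {T a} → T <ℕ a → frac T a < frac (suc T) (suc a)
frac-<-frac-suc-suc {T} {a} T<a = frac-cross-< T (suc T) (ℕ.<-≤-trans (s≤s z≤n) T<a) (s≤s z≤n)
  (subst (_<ℕ a + T * a) (sym (ℕ.*-suc T a)) (ℕ.+-monoˡ-< (T * a) T<a))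

frac-suc-suc-<-frac : ∀ {T a} → 0 <ℕ a → a <ℕ T → frac (suc T) (suc a) < frac T a
frac-suc-suc-<-frac {T} {a} 0<a a<T = frac-cross-< (suc T) T (s≤s z≤n) 0<a
  (subst (a + T * a <ℕ_) (sym (ℕ.*-suc T a)) (ℕ.+-monoˡ-< (T * a) a<T))

frac-≡-frac-suc-suc : ∀ {T a} → 0 <ℕ a → T ≡ a → frac T a ≡ frac (suc T) (suc a)
frac-≡-frac-suc-suc {a = a} 0<a refl = ℚ.≤-antisym
  (frac-cross-≤ a (suc a) 0<a (s≤s z≤n) (ℕ.≤-reflexive (ℕ.*-comm a (suc a))))
  (frac-cross-≤ (suc a) a (s≤s z≤n) 0<a (ℕ.≤-reflexive (ℕ.*-comm (suc a) a)))

lookup-ext : ∀ {a} {A : Set a} {n} {xs ys : Vec A n} →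
  (∀ i → lookup xs i ≡ lookup ys i) → xs ≡ ys
lookup-ext {xs = xs} {ys} xs≗ys = begin
  xs                   ≡⟨ tabulate∘lookup xs ⟨
  tabulate (lookup xs) ≡⟨ tabulate-cong xs≗ys ⟩
  tabulate (lookup ys) ≡⟨ tabulate∘lookup ys ⟩
  ys                   ∎
  where open ≡-Reasoning

∉⇒lookup≡outside : ∀ {n} {p : Subset n} {x} → x ∉ p → lookup p x ≡ outside
∉⇒lookup≡outside {p = p} {x} x∉p with lookup p x in eq
... | outside = refl
... | inside  = contradiction (lookup⇒[]= x p eq) x∉p

x∈p─q⇒x∉q : ∀ {n} (p q : Subset n) {x} → x ∈ p ─ q → x ∉ q
x∈p─q⇒x∉q p q {x} x∈p─q x∈q
  with lookup q x | []=⇒lookup x∈q | trans (sym (lookup-zipWith _ x p q)) ([]=⇒lookup x∈p─q)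
... | inside | refl | ()

x∈p⇒0<∣p∣ : ∀ {n} {p : Subset n} {x} → x ∈ p → 0 <ℕ ∣ p ∣
x∈p⇒0<∣p∣ x∈p = ℕ.≤-<-trans z≤n (x∈p⇒∣p-x∣<∣p∣ x∈p)

-- A record rather than a function, so that i, p and q can be inferred from a proof.
record AgreeOff {n} (i : Fin n) (p q : Subset n) : Set where
  constructor agreeOff
  field lookup-agree : ∀ j → j ≢ i → lookup p j ≡ lookup q j
open AgreeOff

AgreeOff-tail : ∀ {n} {x y} {p q : Subset n} {i} → AgreeOff (suc i) (x ∷ p) (y ∷ q) → AgreeOff i p q
AgreeOff-tail agree = agreeOff λ j j≢i → lookup-agree agree (suc j) (j≢i ∘ suc-injective)

AgreeOff-sym : ∀ {n} {i} {p q : Subset n} → AgreeOff i p q → AgreeOff i q p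
AgreeOff-sym agree = agreeOff λ j j≢i → sym (lookup-agree agree j j≢i)

∣∣-insert : ∀ {n} {p q : Subset n} {i} → AgreeOff i p q →
  lookup p i ≡ outside → lookup q i ≡ inside → ∣ q ∣ ≡ suc ∣ p ∣
∣∣-insert {p = outside ∷ p} {inside ∷ q} {zero} agree refl refl =
  cong (suc ∘ ∣_∣) (lookup-ext {xs = q} {p} λ j → sym (lookup-agree agree (suc j) λ ()))
∣∣-insert {p = x ∷ p} {y ∷ q} {suc i} agree p[i] q[i] with lookup-agree agree zero (λ ())
... | refl with x
...   | inside  = cong suc (∣∣-insert (AgreeOff-tail agree) p[i] q[i])
...   | outside = ∣∣-insert (AgreeOff-tail agree) p[i] q[i]

lookup-Δ : ∀ {n} (p q : Subset n) i → lookup (p Δ q) i ≡ lookup p i xor lookup q i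
lookup-Δ p q i = lookup-zipWith _xor_ i p q

AgreeOff-Δ : ∀ {n} {i} {p q : Subset n} → AgreeOff i p q → ∀ r → AgreeOff i (p Δ r) (q Δ r)
AgreeOff-Δ {p = p} {q} agree r = agreeOff λ j j≢i → begin
  lookup (p Δ r) j          ≡⟨ lookup-Δ p r j ⟩
  lookup p j xor lookup r j ≡⟨ cong (_xor lookup r j) (lookup-agree agree j j≢i) ⟩
  lookup q j xor lookup r j ≡⟨ lookup-Δ q r j ⟨
  lookup (q Δ r) j          ∎
  where open ≡-Reasoning

module _ {n} {i} {p q : Subset n} (agree : AgreeOff i p q)
         (p[i] : lookup p i ≡ outside) (q[i] : lookup q i ≡ inside) (r : Subset n) where

  ∣Δ∣-insert-∈ : i ∈ r → ∣ p Δ r ∣ ≡ suc ∣ q Δ r ∣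
  ∣Δ∣-insert-∈ i∈r = ∣∣-insert (AgreeOff-sym (AgreeOff-Δ agree r))
    (trans (lookup-Δ q r i) (cong₂ _xor_ q[i] ([]=⇒lookup i∈r)))
    (trans (lookup-Δ p r i) (cong₂ _xor_ p[i] ([]=⇒lookup i∈r)))

  ∣Δ∣-insert-∉ : i ∉ r → ∣ q Δ r ∣ ≡ suc ∣ p Δ r ∣
  ∣Δ∣-insert-∉ i∉r = ∣∣-insert (AgreeOff-Δ agree r)
    (trans (lookup-Δ p r i) (cong₂ _xor_ p[i] (∉⇒lookup≡outside i∉r)))
    (trans (lookup-Δ q r i) (cong₂ _xor_ q[i] (∉⇒lookup≡outside i∉r)))

module _ {n} (X : CompleteSignedGraph n) where

  -- N⁺ X a is a tabulate of a local function of (a ≟ b); the ascription makes its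
  -- lookup mention a ≟ b before the with-abstraction.
  lookup-N⁺ : ∀ {a b} → a ≢ b → lookup (N⁺ X a) b ≡ isPlus (sign X a b)
  lookup-N⁺ {a} {b} a≢b with a ≟ b | (lookup (N⁺ X a) b ≡ _) ∋ lookup∘tabulate _ b
  ... | yes a≡b | _  = contradiction a≡b a≢b
  ... | no _    | eq = eq

  N⁺-irrefl : ∀ a → lookup (N⁺ X a) a ≡ outside
  N⁺-irrefl a with a ≟ a | (lookup (N⁺ X a) a ≡ _) ∋ lookup∘tabulate _ a
  ... | yes _   | eq = eq
  ... | no a≢a | _  = contradiction refl a≢a

  lookup-N⁺-sym : ∀ a b → lookup (N⁺ X a) b ≡ lookup (N⁺ X b) a
  lookup-N⁺-sym a b with a ≟ b
  ... | yes refl = refl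
  ... | no a≢b   = begin
    lookup (N⁺ X a) b     ≡⟨ lookup-N⁺ a≢b ⟩
    isPlus (sign X a b)   ≡⟨ cong isPlus (sign-sym X a b) ⟩
    isPlus (sign X b a)   ≡⟨ lookup-N⁺ (a≢b ∘ sym) ⟨
    lookup (N⁺ X b) a     ∎
    where open ≡-Reasoning

  ∈N⁺-sym : ∀ a {b} → b ∈ N⁺ X a → a ∈ N⁺ X b
  ∈N⁺-sym a {b} b∈Na = lookup⇒[]= a (N⁺ X b) (trans (lookup-N⁺-sym b a) ([]=⇒lookup b∈Na))

  ∈N⁺⇒≢ : ∀ a {b} → b ∈ N⁺ X a → b ≢ a
  ∈N⁺⇒≢ a b∈Na refl with trans (sym (N⁺-irrefl a)) ([]=⇒lookup b∈Na)
  ... | ()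

lookup-N⁺-cong : ∀ {n} (X Y : CompleteSignedGraph n) {a b} →
  (a ≢ b → sign X a b ≡ sign Y a b) → lookup (N⁺ X a) b ≡ lookup (N⁺ Y a) b
lookup-N⁺-cong X Y {a} {b} same with a ≟ b
... | yes refl = trans (N⁺-irrefl X a) (sym (N⁺-irrefl Y a))
... | no a≢b   = trans (lookup-N⁺ X a≢b) (trans (cong isPlus (same a≢b)) (sym (lookup-N⁺ Y a≢b)))

module Flip {n} {G H : CompleteSignedGraph n} {u v : Fin n}
         (u≢v : u ≢ v) (uv-minus : sign G u v ≡ minus) (flip : FlipToPlus G H u v) where

  N⁺-unchanged : ∀ {x} → x ≢ u → x ≢ v → N⁺ H x ≡ N⁺ G x
  N⁺-unchanged x≢u x≢v = lookup-ext λ b → lookup-N⁺-cong H G λ x≢b →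
    proj₂ flip _ b x≢b λ { (inj₁ (x≡u , _)) → x≢u x≡u ; (inj₂ (x≡v , _)) → x≢v x≡v }

  N⁺-u-agree : AgreeOff v (N⁺ G u) (N⁺ H u)
  N⁺-u-agree = agreeOff λ j j≢v → lookup-N⁺-cong G H λ u≢j →
    sym (proj₂ flip u j u≢j λ { (inj₁ (_ , j≡v)) → j≢v j≡v ; (inj₂ (u≡v , _)) → u≢v u≡v })

  v∉N⁺Gu : lookup (N⁺ G u) v ≡ outside
  v∉N⁺Gu = trans (lookup-N⁺ G u≢v) (cong isPlus uv-minus)

  v∈N⁺Hu : lookup (N⁺ H u) v ≡ inside
  v∈N⁺Hu = trans (lookup-N⁺ H u≢v) (cong isPlus (proj₁ flip))

  ∣N⁺Hu∣ : ∣ N⁺ H u ∣ ≡ suc ∣ N⁺ G u ∣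
  ∣N⁺Hu∣ = ∣∣-insert N⁺-u-agree v∉N⁺Gu v∈N⁺Hu

  NonAgreement-H-u : ∀ {w} → w ≢ u → w ≢ v →
    NonAgreement H u w ≡ frac ∣ N⁺ H u Δ N⁺ G w ∣ (suc ∣ N⁺ G u ∣ ⊔ ∣ N⁺ G w ∣)
  NonAgreement-H-u {w} w≢u w≢v = begin
    frac ∣ N⁺ H u Δ N⁺ H w ∣ (∣ N⁺ H u ∣ ⊔ ∣ N⁺ H w ∣)
      ≡⟨ cong (λ Nw → frac ∣ N⁺ H u Δ Nw ∣ (∣ N⁺ H u ∣ ⊔ ∣ Nw ∣)) (N⁺-unchanged w≢u w≢v) ⟩
    frac ∣ N⁺ H u Δ N⁺ G w ∣ (∣ N⁺ H u ∣ ⊔ ∣ N⁺ G w ∣)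
      ≡⟨ cong (λ d → frac ∣ N⁺ H u Δ N⁺ G w ∣ (d ⊔ ∣ N⁺ G w ∣)) ∣N⁺Hu∣ ⟩
    frac ∣ N⁺ H u Δ N⁺ G w ∣ (suc ∣ N⁺ G u ∣ ⊔ ∣ N⁺ G w ∣) ∎
    where open ≡-Reasoning

  flip-decreases-NonAgreement-common : ∀ {w} → w ∈ N⁺ G u ∩ N⁺ G v →
    NonAgreement H u w ≤ NonAgreement G u w
  flip-decreases-NonAgreement-common {w} w∈Nu∩Nv = begin
    NonAgreement H u w    ≡⟨ NonAgreement-H-u (∈N⁺⇒≢ G u w∈Nu) (∈N⁺⇒≢ G v w∈Nv) ⟩
    frac T (suc a ⊔ m)    ≤⟨ frac-mono-≤ (ℕ.n≤1+n T) (ℕ.⊔-monoˡ-≤ m (ℕ.n≤1+n a)) 0<a⊔m ⟩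
    frac (suc T) (a ⊔ m)  ≡⟨ cong (λ t → frac t (a ⊔ m)) ∣Δ∣-G≡suc∣Δ∣-H ⟨
    NonAgreement G u w    ∎
    where
    open ℚ.≤-Reasoning
    w∈Nu = proj₁ (x∈p∩q⁻ (N⁺ G u) (N⁺ G v) w∈Nu∩Nv)
    w∈Nv = proj₂ (x∈p∩q⁻ (N⁺ G u) (N⁺ G v) w∈Nu∩Nv)
    T = ∣ N⁺ H u Δ N⁺ G w ∣
    a = ∣ N⁺ G u ∣
    m = ∣ N⁺ G w ∣
    0<a⊔m : 0 <ℕ a ⊔ m
    0<a⊔m = ℕ.<-≤-trans (x∈p⇒0<∣p∣ w∈Nu) (ℕ.m≤m⊔n a m)
    ∣Δ∣-G≡suc∣Δ∣-H : ∣ N⁺ G u Δ N⁺ G w ∣ ≡ suc T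
    ∣Δ∣-G≡suc∣Δ∣-H = ∣Δ∣-insert-∈ N⁺-u-agree v∉N⁺Gu v∈N⁺Hu (N⁺ G w) (∈N⁺-sym G v w∈Nv)

  module _ {w} (w∈Nu─Nv : w ∈ N⁺ G u ─ N⁺ G v) (w≢v : w ≢ v) where
    private
      T = ∣ N⁺ G u Δ N⁺ G w ∣
      a = ∣ N⁺ G u ∣
      m = ∣ N⁺ G w ∣
      w∈Nu : w ∈ N⁺ G u
      w∈Nu = p─q⊆p (N⁺ G u) (N⁺ G v) w∈Nu─Nv
      v∉Nw : v ∉ N⁺ G w
      v∉Nw v∈Nw = x∈p─q⇒x∉q (N⁺ G u) (N⁺ G v) w∈Nu─Nv (∈N⁺-sym G w v∈Nw)

    NonAgreement-H-u-exclusive : NonAgreement H u w ≡ frac (suc T) (suc a ⊔ m)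
    NonAgreement-H-u-exclusive =
      trans (NonAgreement-H-u (∈N⁺⇒≢ G u w∈Nu) w≢v)
            (cong (λ t → frac t (suc a ⊔ m)) (∣Δ∣-insert-∉ N⁺-u-agree v∉N⁺Gu v∈N⁺Hu (N⁺ G w) v∉Nw))

    flip-increases-NonAgreement-exclusive : a <ℕ m → NonAgreement G u w < NonAgreement H u w
    flip-increases-NonAgreement-exclusive a<m = begin-strict
      NonAgreement G u w        ≡⟨ cong (frac T) (ℕ.m≤n⇒m⊔n≡n (ℕ.<⇒≤ a<m)) ⟩
      frac T m                  <⟨ frac-monoˡ-< (ℕ.n<1+n T) (ℕ.≤-<-trans z≤n a<m) ⟩
      frac (suc T) m            ≡⟨ cong (frac (suc T)) (ℕ.m≤n⇒m⊔n≡n a<m) ⟨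
      frac (suc T) (suc a ⊔ m)  ≡⟨ NonAgreement-H-u-exclusive ⟨
      NonAgreement H u w        ∎
      where open ℚ.≤-Reasoning

    flip-NonAgreement-exclusive-trichotomy : m ≤ℕ a →
        (T <ℕ a → NonAgreement G u w < NonAgreement H u w)
      × (T ≡ a → NonAgreement G u w ≡ NonAgreement H u w)
      × (T >ℕ a → NonAgreement G u w > NonAgreement H u w)
    flip-NonAgreement-exclusive-trichotomy m≤a =
        (λ T<a → subst₂ _<_ (sym G≡) (sym H≡) (frac-<-frac-suc-suc T<a))
      , (λ T≡a → trans G≡ (trans (frac-≡-frac-suc-suc 0<a T≡a) (sym H≡)))
      , (λ a<T → subst₂ _<_ (sym H≡) (sym G≡) (frac-suc-suc-<-frac 0<a a<T))
      where
      0<a : 0 <ℕ a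
      0<a = x∈p⇒0<∣p∣ w∈Nu
      G≡ : NonAgreement G u w ≡ frac T a
      G≡ = cong (frac T) (ℕ.m≥n⇒m⊔n≡m m≤a)
      H≡ : NonAgreement H u w ≡ frac (suc T) (suc a)
      H≡ = trans NonAgreement-H-u-exclusive (cong (frac (suc T)) (ℕ.m≥n⇒m⊔n≡m (ℕ.m≤n⇒m≤1+n m≤a)))

  flip-preserves-NonAgreement-far : ∀ {w} → w ∉ N⁺ G u ∪ N⁺ G v → w ≢ u → w ≢ v →
    ∀ {x} → x ∈ N⁺ G w → NonAgreement G x w ≡ NonAgreement H x w
  flip-preserves-NonAgreement-far {w} w∉Nu∪Nv w≢u w≢v {x} x∈Nw =
    cong₂ (λ Nx Nw → frac ∣ Nx Δ Nw ∣ (∣ Nx ∣ ⊔ ∣ Nw ∣))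
          (sym (N⁺-unchanged x≢u x≢v)) (sym (N⁺-unchanged w≢u w≢v))
    where
    x≢u : x ≢ u
    x≢u refl = w∉Nu∪Nv (x∈p∪q⁺ (inj₁ (∈N⁺-sym G w x∈Nw)))
    x≢v : x ≢ v
    x≢v refl = w∉Nu∪Nv (x∈p∪q⁺ (inj₂ (∈N⁺-sym G w x∈Nw)))

lemma1 : ∀ (n : ℕ) (G H : CompleteSignedGraph n) (u v : Fin n) →
    u ≢ v → sign G u v ≡ minus → FlipToPlus G H u v →
    (∀ w → w ∈ N⁺ G u ∩ N⁺ G v → NonAgreement G u w ≥ NonAgreement H u w)
    × (∀ w → w ∈ N⁺ G u ─ N⁺ G v → ∣ N⁺ G u ∣ <ℕ ∣ N⁺ G w ∣ → w ≢ v →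
        NonAgreement G u w < NonAgreement H u w)
    × (∀ w → w ∈ N⁺ G u ─ N⁺ G v → ∣ N⁺ G u ∣ ≥ℕ ∣ N⁺ G w ∣ → w ≢ v →
        (∣ N⁺ G u Δ N⁺ G w ∣ <ℕ ∣ N⁺ G u ∣ → NonAgreement G u w < NonAgreement H u w)
        × (∣ N⁺ G u Δ N⁺ G w ∣ ≡ ∣ N⁺ G u ∣ → NonAgreement G u w ≡ NonAgreement H u w)
        × (∣ N⁺ G u Δ N⁺ G w ∣ >ℕ ∣ N⁺ G u ∣ → NonAgreement G u w > NonAgreement H u w))
    × (∀ w → w ∉ N⁺ G u ∪ N⁺ G v → w ≢ u → w ≢ v →
        ∀ x → x ∈ N⁺ G w → NonAgreement G x w ≡ NonAgreement H x w)
lemma1 n G H u v u≢v uv-minus flip =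
    (λ _ → flip-decreases-NonAgreement-common)
  , (λ _ w∈Nu─Nv a<m w≢v → flip-increases-NonAgreement-exclusive w∈Nu─Nv w≢v a<m)
  , (λ _ w∈Nu─Nv m≤a w≢v → flip-NonAgreement-exclusive-trichotomy w∈Nu─Nv w≢v m≤a)
  , (λ _ w∉Nu∪Nv w≢u w≢v _ → flip-preserves-NonAgreement-far w∉Nu∪Nv w≢u w≢v)
  where open Flip u≢v uv-minus flip
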